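{- Let $p=(0,-1,-2,\ldots,-n,n,n-1,\ldots,1)$ and let $s=(0,s_1,s_2,\ldots,s_n,-s_n,-s_{n-1},\ldots,-s_1)$, both being $(2n+1)$-cycles on the set $[n]^{\pm}=\{ -n,-n+1,\ldots,0,1,\ldots,n\}$. Then $n$ and $s_n$ lie in the same cycle of the permutation $p\circ s$.
   Context: Permutations are composed right to left: $(p\circ s)(x)=p(s(x))$. -}

module Defs where

open import Data.Nat using (ℕ; zero; suc)
open import Data.Integer using (ℤ; +_; -_; _≟_)
open import Data.Fin using (Fin)
open import Data.List using (List; []; _∷_; _++_; map; upTo; downFrom; reverse; tabulate)
open import Data.Bool using (if_then_else_)
open import Relation.Nullary using (does)

-- The permutation of ℤ given by a single cycle written as a list
-- (a₀ a₁ … a_k): aᵢ ↦ aᵢ₊₁, a_k ↦ a₀, every other integer fixed.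
cycleNext : ℤ → List ℤ → ℤ → ℤ
cycleNext h [] x = x
cycleNext h (a ∷ []) x = if does (a ≟ x) then h else x
cycleNext h (a ∷ b ∷ rest) x = if does (a ≟ x) then b else cycleNext h (b ∷ rest) x

cyclePerm : List ℤ → ℤ → ℤ
cyclePerm [] x = x
cyclePerm (a ∷ l) x = cycleNext a (a ∷ l) x

pList : ℕ → List ℤ
pList n = + 0 ∷ (map (λ k → - (+ suc k)) (upTo n) ++ map (λ k → + suc k) (downFrom n))

-- s = (0, s₁, …, sₙ, -sₙ, …, -s₁), with sv i = s_{i+1}
sList : {n : ℕ} → (Fin n → ℤ) → List ℤ
sList sv = + 0 ∷ (tabulate sv ++ map -_ (reverse (tabulate sv)))

compose : (ℤ → ℤ) → (ℤ → ℤ) → ℤ → ℤ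
compose f g x = f (g x)

iter : (ℤ → ℤ) → ℕ → ℤ → ℤ
iter f zero x = x
iter f (suc k) x = f (iter f k x)

module Submission where

-- Write ρ x = p (- x) and τ x = - (s x), so that σ = p ∘ s = ρ ∘ τ.
--
-- A cycle of the shape c = (0, t₁, …, t_k, -t_k, …, -t₁) is "antisymmetric":
-- reading its closed walk 0 t₁ … -t₁ 0 backwards with all signs flipped gives
-- the same walk, hence c (- c x) = - x.  Consequently ρ and τ are involutions,
-- and the only x with c x = - x is the middle entry t_k.  So τ has the unique
-- fixed point sₙ, while ρ has the unique fixed point n (because p(-n) = n).
--
-- The σ-orbit of n stays inside the finite support of p and s, so σ^L n = n
-- for some L > 0.  On this orbit ρ and τ act as reflections of a polygon
-- (σ ∘ r ∘ σ = r for r = ρ, τ).  If L = 2h, then ρ fixes σ^h n, so σ^h n = n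
-- and we descend to the period h; if L = 2j+1, then τ fixes σ^j n, which
-- therefore equals sₙ.

open import Defs
open import Data.Nat using (ℕ; zero; suc; _+_; _*_; _∸_; _<_; s≤s; z≤n)
open import Data.Nat.Properties
  using (+-suc; +-identityʳ; *-cancelˡ-≡; suc-injective; <-irrefl; m≤n+m;
         m<n⇒0<n∸m; <⇒≤; m+[n∸m]≡n; n<1+n)
open import Data.Nat.Induction using (<-rec)
open import Data.Integer using (ℤ; +_; -_; _≤_; _≟_)
open import Data.Integer.Properties using (neg-involutive; neg-injective)
open import Data.Fin as Fin using (Fin; fromℕ; toℕ)
open import Data.Fin.Properties using (pigeonhole)
open import Data.Product using (_×_; _,_; ∃-syntax)
open import Data.Sum using (_⊎_; inj₁; inj₂)
open import Data.Empty using (⊥; ⊥-elim)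
open import Data.List
  using (List; []; _∷_; _++_; [_]; map; reverse; length; upTo; downFrom; tabulate; lookup)
open import Data.List.Properties
  using (∷-injectiveˡ; ∷-injectiveʳ; map-++; map-∘; map-cong; map-id; reverse-++; reverse-map;
         reverse-involutive; reverse-upTo; ++-assoc; length-++; length-map; length-reverse; upTo-∷ʳ)
open import Data.List.Relation.Unary.All as All using (All; []; _∷_)
open import Data.List.Relation.Unary.Any using (here; there; index)
open import Data.List.Relation.Unary.Any.Properties using (lookup-index; reverse⁺)
open import Data.List.Relation.Unary.AllPairs using (_∷_)
open import Data.List.Relation.Unary.Unique.Propositional using (Unique)
import Data.List.Relation.Unary.Unique.Propositional.Properties as Unique
open import Data.List.Relation.Binary.Subset.Propositional using (_⊆_)
open import Data.List.Membership.Propositional using (_∈_; _∉_)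
open import Data.List.Membership.Propositional.Properties using (∈-map⁺; ∈-map⁻; ∈-++⁺ˡ; ∈-++⁺ʳ; ∈-++⁻)
open import Data.List.Membership.DecPropositional _≟_ using (_∈?_)
open import Function.Definitions using (Injective)
open import Relation.Nullary using (yes; no)
open import Relation.Binary.PropositionalEquality
  using (_≡_; _≢_; refl; sym; trans; cong; cong₂; subst; module ≡-Reasoning)

-- The cycle of a list.  cycleNext h xs follows the closed walk xs ++ [ h ]:
-- an entry of xs is sent to the entry right after it in that walk, and
-- every other integer is fixed.

walk-source-∈ : ∀ {h x y : ℤ} {r} xs l → xs ++ [ h ] ≡ l ++ x ∷ y ∷ r → x ∈ xs
walk-source-∈ [] [] ()
walk-source-∈ [] (_ ∷ []) ()
walk-source-∈ [] (_ ∷ _ ∷ _) ()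
walk-source-∈ (b ∷ xs) [] eq = here (sym (∷-injectiveˡ eq))
walk-source-∈ (b ∷ xs) (_ ∷ l) eq = there (walk-source-∈ xs l (∷-injectiveʳ eq))

cycleNext-skip : ∀ h b c xs x → b ≢ x → cycleNext h (b ∷ c ∷ xs) x ≡ cycleNext h (c ∷ xs) x
cycleNext-skip h b c xs x b≢x with b ≟ x
... | yes b≡x = ⊥-elim (b≢x b≡x)
... | no _ = refl

cycleNext-step : ∀ {h x y : ℤ} {r} xs l → Unique xs → xs ++ [ h ] ≡ l ++ x ∷ y ∷ r → cycleNext h xs x ≡ y
cycleNext-step [] l _ eq with walk-source-∈ [] l eq
... | ()
cycleNext-step (b ∷ []) [] _ refl with b ≟ b
... | yes _ = refl
... | no b≢b = ⊥-elim (b≢b refl)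
cycleNext-step (b ∷ c ∷ xs) [] _ refl with b ≟ b
... | yes _ = refl
... | no b≢b = ⊥-elim (b≢b refl)
cycleNext-step (b ∷ []) (_ ∷ l) _ eq with walk-source-∈ [] l (∷-injectiveʳ eq)
... | ()
cycleNext-step {h} {x} {y} {r} (b ∷ c ∷ xs) (_ ∷ l) (b∉ ∷ u) eq =
  trans (cycleNext-skip h b c xs x (All.lookup b∉ (walk-source-∈ (c ∷ xs) l eq′)))
        (cycleNext-step (c ∷ xs) l u eq′)
  where
  eq′ : (c ∷ xs) ++ [ h ] ≡ l ++ x ∷ y ∷ r
  eq′ = ∷-injectiveʳ eq

cycleNext-outside : ∀ h xs x → x ∉ xs → cycleNext h xs x ≡ x
cycleNext-outside h [] x _ = refl
cycleNext-outside h (a ∷ []) x x∉ with a ≟ x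
... | yes a≡x = ⊥-elim (x∉ (here (sym a≡x)))
... | no _ = refl
cycleNext-outside h (a ∷ b ∷ xs) x x∉ =
  trans (cycleNext-skip h a b xs x (λ a≡x → x∉ (here (sym a≡x))))
        (cycleNext-outside h (b ∷ xs) x (λ x∈ → x∉ (there x∈)))

walk-step-from : ∀ (h : ℤ) xs {x} → x ∈ xs → ∃[ l ] ∃[ y ] ∃[ r ] (xs ++ [ h ] ≡ l ++ x ∷ y ∷ r)
walk-step-from h (b ∷ []) (here refl) = [] , h , [] , refl
walk-step-from h (b ∷ c ∷ xs) (here refl) = [] , c , xs ++ [ h ] , refl
walk-step-from h (b ∷ xs) (there x∈) with walk-step-from h xs x∈
... | l , y , r , eq = b ∷ l , y , r , cong (b ∷_) eq

cycleNext-successor : ∀ h xs {x} → Unique xs → x ∈ xs →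
                      ∃[ l ] ∃[ r ] (xs ++ [ h ] ≡ l ++ x ∷ cycleNext h xs x ∷ r)
cycleNext-successor h xs {x} u x∈ with walk-step-from h xs x∈
... | l , y , r , eq =
  l , r , subst (λ z → xs ++ [ h ] ≡ l ++ x ∷ z ∷ r) (sym (cycleNext-step xs l u eq)) eq

walk-prefix-unique : ∀ {h x y y′ : ℤ} {r r′} xs l k → Unique xs →
                     xs ++ [ h ] ≡ l ++ x ∷ y ∷ r → xs ++ [ h ] ≡ k ++ x ∷ y′ ∷ r′ → l ≡ k
walk-prefix-unique [] l k _ eq _ with walk-source-∈ [] l eq
... | ()
walk-prefix-unique (b ∷ xs) [] [] _ _ _ = refl
walk-prefix-unique (b ∷ xs) [] (_ ∷ k) (b∉ ∷ _) eq eq′ =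
  ⊥-elim (All.lookup b∉ (walk-source-∈ xs k (∷-injectiveʳ eq′)) (∷-injectiveˡ eq))
walk-prefix-unique (b ∷ xs) (_ ∷ l) [] (b∉ ∷ _) eq eq′ =
  ⊥-elim (All.lookup b∉ (walk-source-∈ xs l (∷-injectiveʳ eq)) (∷-injectiveˡ eq′))
walk-prefix-unique (b ∷ xs) (_ ∷ l) (_ ∷ k) (_ ∷ u) eq eq′ =
  cong₂ _∷_ (trans (sym (∷-injectiveˡ eq)) (∷-injectiveˡ eq′))
            (walk-prefix-unique xs l k u (∷-injectiveʳ eq) (∷-injectiveʳ eq′))

cycleNext-closed : ∀ {R} (h : ℤ) xs {x} → h ∈ R → All (_∈ R) xs → x ∈ R → cycleNext h xs x ∈ R
cycleNext-closed h [] h∈ [] x∈ = x∈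
cycleNext-closed h (a ∷ []) {x} h∈ (_ ∷ []) x∈ with a ≟ x
... | yes _ = h∈
... | no _ = x∈
cycleNext-closed h (a ∷ b ∷ xs) {x} h∈ (_ ∷ bs∈) x∈ with a ≟ x
... | yes _ = All.head bs∈
... | no _ = cycleNext-closed h (b ∷ xs) h∈ bs∈ x∈

cyclePerm-closed : ∀ {R} L {x} → L ⊆ R → x ∈ R → cyclePerm L x ∈ R
cyclePerm-closed [] _ x∈ = x∈
cyclePerm-closed (a ∷ l) L⊆R x∈ = cycleNext-closed a (a ∷ l) (L⊆R (here refl)) (All.tabulate L⊆R) x∈

-- Antisymmetric cycles (0, t₁, …, t_k, -t_k, …, -t₁).

negrev : List ℤ → List ℤ
negrev l = map -_ (reverse l)

negrev-++ : ∀ a b → negrev (a ++ b) ≡ negrev b ++ negrev a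
negrev-++ a b = trans (cong (map -_) (reverse-++ a b)) (map-++ -_ (reverse b) (reverse a))

negrev-involutive : ∀ l → negrev (negrev l) ≡ l
negrev-involutive l = begin
  map -_ (reverse (map -_ (reverse l)))   ≡⟨ cong (map -_) (sym (reverse-map -_ (reverse l))) ⟩
  map -_ (map -_ (reverse (reverse l)))   ≡⟨ sym (map-∘ (reverse (reverse l))) ⟩
  map (λ x → - - x) (reverse (reverse l)) ≡⟨ map-cong neg-involutive (reverse (reverse l)) ⟩
  map (λ x → x) (reverse (reverse l))     ≡⟨ map-id (reverse (reverse l)) ⟩
  reverse (reverse l)                     ≡⟨ reverse-involutive l ⟩
  l                                       ∎
  where open ≡-Reasoning

negrev-step : ∀ l x y r → negrev (l ++ x ∷ y ∷ r) ≡ negrev r ++ (- y) ∷ (- x) ∷ negrev l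
negrev-step l x y r = begin
  negrev (l ++ x ∷ y ∷ r)                  ≡⟨ negrev-++ l (x ∷ y ∷ r) ⟩
  negrev ([ x ] ++ [ y ] ++ r) ++ negrev l ≡⟨ cong (_++ negrev l) (negrev-++ (x ∷ y ∷ []) r) ⟩
  (negrev r ++ (- y) ∷ (- x) ∷ []) ++ negrev l ≡⟨ ++-assoc (negrev r) _ (negrev l) ⟩
  negrev r ++ (- y) ∷ (- x) ∷ negrev l     ∎
  where open ≡-Reasoning

antisym : List ℤ → List ℤ
antisym t = + 0 ∷ (t ++ negrev t)

antisym-walk : List ℤ → List ℤ
antisym-walk t = antisym t ++ [ + 0 ]

antisym-walk-self-mirror : ∀ t → negrev (antisym-walk t) ≡ antisym-walk t
antisym-walk-self-mirror t = begin
  negrev (antisym-walk t)                          ≡⟨ negrev-++ (antisym t) [ + 0 ] ⟩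
  + 0 ∷ negrev (+ 0 ∷ (t ++ negrev t))            ≡⟨ cong (+ 0 ∷_) (negrev-++ [ + 0 ] (t ++ negrev t)) ⟩
  + 0 ∷ negrev (t ++ negrev t) ++ [ + 0 ]          ≡⟨ cong (λ z → + 0 ∷ z ++ [ + 0 ]) (negrev-++ t (negrev t)) ⟩
  + 0 ∷ (negrev (negrev t) ++ negrev t) ++ [ + 0 ] ≡⟨ cong (λ z → + 0 ∷ (z ++ negrev t) ++ [ + 0 ]) (negrev-involutive t) ⟩
  antisym-walk t                                   ∎
  where open ≡-Reasoning

entry-after-equal-prefixes : ∀ {A : Set} (l k : List A) {x x′ : A} {r r′} →
                             l ++ x ∷ r ≡ k ++ x′ ∷ r′ → length l ≡ length k → x ≡ x′
entry-after-equal-prefixes [] [] eq _ = ∷-injectiveˡ eq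
entry-after-equal-prefixes (_ ∷ l) (_ ∷ k) eq len =
  entry-after-equal-prefixes l k (∷-injectiveʳ eq) (suc-injective len)

mirrored-length : ∀ a {x y} → length (a ++ x ∷ y ∷ negrev a) ≡ 2 * suc (length a)
mirrored-length a {x} {y} = begin
  length (a ++ x ∷ y ∷ negrev a)          ≡⟨ length-++ a ⟩
  length a + suc (suc (length (negrev a))) ≡⟨ cong (λ n → length a + suc (suc n)) negrev-length ⟩
  length a + suc (suc (length a))          ≡⟨ +-suc (length a) (suc (length a)) ⟩
  suc (length a + suc (length a))          ≡⟨ cong (λ n → suc (length a + suc n)) (sym (+-identityʳ (length a))) ⟩
  2 * suc (length a)                       ∎
  where
  open ≡-Reasoning
  negrev-length : length (negrev a) ≡ length a
  negrev-length = trans (length-map -_ (reverse a)) (length-reverse a)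

mirrored-centre : ∀ a b {x y x′ y′} → a ++ x ∷ y ∷ negrev a ≡ b ++ x′ ∷ y′ ∷ negrev b → x ≡ x′
mirrored-centre a b eq = entry-after-equal-prefixes a b eq same-length
  where
  same-length : length a ≡ length b
  same-length = suc-injective (*-cancelˡ-≡ _ _ 2
    (trans (sym (mirrored-length a)) (trans (cong length eq) (mirrored-length b))))

self-negative-is-zero : ∀ (x : ℤ) → x ≡ - x → x ≡ + 0
self-negative-is-zero (+ zero) _ = refl

module Antisymmetric (t : List ℤ) (u : Unique (antisym t)) where

  c : ℤ → ℤ
  c = cyclePerm (antisym t)

  successor : ∀ {x} → x ∈ antisym t → ∃[ l ] ∃[ r ] (antisym-walk t ≡ l ++ x ∷ c x ∷ r)
  successor = cycleNext-successor (+ 0) (antisym t) u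

  mirror : ∀ {l x y r} → antisym-walk t ≡ l ++ x ∷ y ∷ r → antisym-walk t ≡ negrev r ++ (- y) ∷ (- x) ∷ negrev l
  mirror {l} {x} {y} {r} eq =
    trans (sym (antisym-walk-self-mirror t)) (trans (cong negrev eq) (negrev-step l x y r))

  negation-closed : ∀ {z} → z ∈ antisym t → - z ∈ antisym t
  negation-closed {z} z∈ with ∈-++⁻ (antisym t) -z∈walk
    where
    -z∈walk : - z ∈ antisym-walk t
    -z∈walk = subst (- z ∈_) (antisym-walk-self-mirror t) (∈-map⁺ -_ (reverse⁺ (∈-++⁺ˡ z∈)))
  ... | inj₁ -z∈ = -z∈
  ... | inj₂ (here -z≡0) = here -z≡0

  -- A step x → c x of the walk mirrors to the step - c x → - x.
  anti-involutive : ∀ x → c (- c x) ≡ - x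
  anti-involutive x with x ∈? antisym t
  ... | yes x∈ with successor x∈
  ...   | l , r , eq = cycleNext-step (antisym t) (negrev r) u (mirror eq)
  anti-involutive x | no x∉ = begin
    c (- c x) ≡⟨ cong (λ z → c (- z)) (cycleNext-outside (+ 0) (antisym t) x x∉) ⟩
    c (- x)   ≡⟨ cycleNext-outside (+ 0) (antisym t) (- x) -x∉ ⟩
    - x       ∎
    where
    open ≡-Reasoning
    -x∉ : - x ∉ antisym t
    -x∉ -x∈ = x∉ (subst (_∈ antisym t) (neg-involutive x) (negation-closed -x∈))

module AntisymmetricEnd (t′ : List ℤ) (e : ℤ) (u : Unique (antisym (t′ ++ [ e ]))) where
  open Antisymmetric (t′ ++ [ e ]) u public

  walk-centred : antisym-walk (t′ ++ [ e ]) ≡ (+ 0 ∷ t′) ++ e ∷ (- e) ∷ negrev (+ 0 ∷ t′)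
  walk-centred = cong (+ 0 ∷_) (begin
    ((t′ ++ [ e ]) ++ negrev (t′ ++ [ e ])) ++ [ + 0 ] ≡⟨ ++-assoc (t′ ++ [ e ]) (negrev (t′ ++ [ e ])) [ + 0 ] ⟩
    (t′ ++ [ e ]) ++ negrev (t′ ++ [ e ]) ++ [ + 0 ]   ≡⟨ cong (λ z → (t′ ++ [ e ]) ++ z ++ [ + 0 ]) (negrev-++ t′ [ e ]) ⟩
    (t′ ++ [ e ]) ++ (- e) ∷ negrev t′ ++ [ + 0 ]      ≡⟨ ++-assoc t′ [ e ] _ ⟩
    t′ ++ e ∷ (- e) ∷ negrev t′ ++ [ + 0 ]             ≡⟨ cong (λ z → t′ ++ e ∷ (- e) ∷ z) (sym (negrev-++ [ + 0 ] t′)) ⟩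
    t′ ++ e ∷ (- e) ∷ negrev (+ 0 ∷ t′)                ∎)
    where open ≡-Reasoning

  maps-end : c e ≡ - e
  maps-end = cycleNext-step (antisym (t′ ++ [ e ])) (+ 0 ∷ t′) u walk-centred

  negates-only-end : ∀ x → c x ≡ - x → x ≡ e
  negates-only-end x cx≡-x with x ∈? antisym (t′ ++ [ e ])
  ... | no x∉ = ⊥-elim (x∉ (here (self-negative-is-zero x
          (trans (sym (cycleNext-outside (+ 0) _ x x∉)) cx≡-x))))
  ... | yes x∈ with successor x∈
  ...   | l , r , eq = mirrored-centre l (+ 0 ∷ t′) (trans (sym centred-at-x) walk-centred)
    where
    step-x : antisym-walk (t′ ++ [ e ]) ≡ l ++ x ∷ (- x) ∷ r
    step-x = subst (λ y → antisym-walk (t′ ++ [ e ]) ≡ l ++ x ∷ y ∷ r) cx≡-x eq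
    step-x′ : antisym-walk (t′ ++ [ e ]) ≡ negrev r ++ x ∷ (- x) ∷ negrev l
    step-x′ = subst (λ z → antisym-walk (t′ ++ [ e ]) ≡ negrev r ++ z ∷ (- x) ∷ negrev l)
                    (neg-involutive x) (mirror step-x)
    -- x starts only one step of the walk, so both decompositions coincide.
    r≡negrev-l : r ≡ negrev l
    r≡negrev-l = trans (sym (negrev-involutive r))
      (cong negrev (sym (walk-prefix-unique (antisym (t′ ++ [ e ])) l (negrev r) u step-x step-x′)))
    centred-at-x : antisym-walk (t′ ++ [ e ]) ≡ l ++ x ∷ (- x) ∷ negrev l
    centred-at-x = subst (λ z → antisym-walk (t′ ++ [ e ]) ≡ l ++ x ∷ (- x) ∷ z) r≡negrev-l step-x

-- Iterates and finite orbits.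

iter-suc′ : ∀ (f : ℤ → ℤ) j x → iter f (suc j) x ≡ iter f j (f x)
iter-suc′ f zero x = refl
iter-suc′ f (suc j) x = cong f (iter-suc′ f j x)

iter-+ : ∀ (f : ℤ → ℤ) a b x → iter f (a + b) x ≡ iter f a (iter f b x)
iter-+ f zero b x = refl
iter-+ f (suc a) b x = cong f (iter-+ f a b x)

iter-injective : ∀ {f : ℤ → ℤ} → Injective _≡_ _≡_ f → ∀ j → Injective _≡_ _≡_ (iter f j)
iter-injective f-inj zero eq = eq
iter-injective f-inj (suc j) eq = iter-injective f-inj j (f-inj eq)

iter-reverses : ∀ (f r : ℤ → ℤ) → (∀ x → f (r (f x)) ≡ r x) → ∀ j x → iter f j (r (iter f j x)) ≡ r x
iter-reverses f r f-rev zero x = refl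
iter-reverses f r f-rev (suc j) x = begin
  iter f (suc j) (r (f (iter f j x))) ≡⟨ iter-suc′ f j _ ⟩
  iter f j (f (r (f (iter f j x))))   ≡⟨ cong (iter f j) (f-rev (iter f j x)) ⟩
  iter f j (r (iter f j x))           ≡⟨ iter-reverses f r f-rev j x ⟩
  r x                                 ∎
  where open ≡-Reasoning

orbit-∈ : ∀ {f : ℤ → ℤ} {R : List ℤ} → (∀ {y} → y ∈ R → f y ∈ R) → ∀ {x} → x ∈ R → ∀ i → iter f i x ∈ R
orbit-∈ closed x∈ zero = x∈
orbit-∈ closed x∈ (suc i) = closed (orbit-∈ closed x∈ i)

-- An injective map sending a finite set into itself returns to every point
-- of that set (pigeonhole on the first |R| + 1 iterates).
orbit-returns : ∀ {f : ℤ → ℤ} → Injective _≡_ _≡_ f → (R : List ℤ) → (∀ {y} → y ∈ R → f y ∈ R) →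
                ∀ {x} → x ∈ R → ∃[ d ] (0 < d × iter f d x ≡ x)
orbit-returns {f} f-inj R closed {x} x∈
  with pigeonhole (n<1+n (length R)) (λ i → index (orbit-∈ closed x∈ (toℕ i)))
... | i , j , i<j , same-index = toℕ j ∸ toℕ i , m<n⇒0<n∸m i<j , iter-injective f-inj (toℕ i) shifted
  where
  open ≡-Reasoning
  same-point : iter f (toℕ i) x ≡ iter f (toℕ j) x
  same-point = trans (lookup-index (orbit-∈ closed x∈ (toℕ i)))
    (trans (cong (lookup R) same-index) (sym (lookup-index (orbit-∈ closed x∈ (toℕ j)))))
  shifted : iter f (toℕ i) (iter f (toℕ j ∸ toℕ i) x) ≡ iter f (toℕ i) x
  shifted = begin
    iter f (toℕ i) (iter f (toℕ j ∸ toℕ i) x) ≡⟨ iter-+ f (toℕ i) (toℕ j ∸ toℕ i) x ⟨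
    iter f (toℕ i + (toℕ j ∸ toℕ i)) x       ≡⟨ cong (λ k → iter f k x) (m+[n∸m]≡n (<⇒≤ i<j)) ⟩
    iter f (toℕ j) x                          ≡⟨ same-point ⟨
    iter f (toℕ i) x                          ∎

-- Two reflections.

parity : ∀ L → ∃[ h ] (L ≡ h + h ⊎ L ≡ suc (h + h))
parity zero = 0 , inj₁ refl
parity (suc L) with parity L
... | h , inj₁ L≡h+h = h , inj₂ (cong suc L≡h+h)
... | h , inj₂ L≡1+h+h = suc h , inj₁ (trans (cong suc L≡1+h+h) (cong suc (sym (+-suc h h))))

-- σ = ρ ∘ τ for two involutions ρ and τ, so that ⟨ρ, τ⟩ acts on every
-- σ-orbit like a dihedral group.
module Reflections (ρ τ σ : ℤ → ℤ) (ρ-involutive : ∀ x → ρ (ρ x) ≡ x)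
                   (τ-involutive : ∀ x → τ (τ x) ≡ x) (σ≗ρ∘τ : ∀ x → σ x ≡ ρ (τ x)) where
  open ≡-Reasoning

  σ-injective : Injective _≡_ _≡_ σ
  σ-injective {x} {y} σx≡σy = begin
    x       ≡⟨ τ-involutive x ⟨
    τ (τ x) ≡⟨ cong τ τx≡τy ⟩
    τ (τ y) ≡⟨ τ-involutive y ⟩
    y       ∎
    where
    τx≡τy : τ x ≡ τ y
    τx≡τy = begin
      τ x           ≡⟨ ρ-involutive (τ x) ⟨
      ρ (ρ (τ x))   ≡⟨ cong ρ (trans (sym (σ≗ρ∘τ x)) (trans σx≡σy (σ≗ρ∘τ y))) ⟩
      ρ (ρ (τ y))   ≡⟨ ρ-involutive (τ y) ⟩
      τ y           ∎

  σ∘τ≗ρ : ∀ x → σ (τ x) ≡ ρ x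
  σ∘τ≗ρ x = trans (σ≗ρ∘τ (τ x)) (cong ρ (τ-involutive x))

  ρ-reverses : ∀ x → σ (ρ (σ x)) ≡ ρ x
  ρ-reverses x = begin
    σ (ρ (σ x))       ≡⟨ cong (λ z → σ (ρ z)) (σ≗ρ∘τ x) ⟩
    σ (ρ (ρ (τ x)))   ≡⟨ cong σ (ρ-involutive (τ x)) ⟩
    σ (τ x)           ≡⟨ σ∘τ≗ρ x ⟩
    ρ x               ∎

  τ-reverses : ∀ x → σ (τ (σ x)) ≡ τ x
  τ-reverses x = begin
    σ (τ (σ x))       ≡⟨ σ∘τ≗ρ (σ x) ⟩
    ρ (σ x)           ≡⟨ cong ρ (σ≗ρ∘τ x) ⟩
    ρ (ρ (τ x))       ≡⟨ ρ-involutive (τ x) ⟩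
    τ x               ∎

  module _ {x : ℤ} (ρx≡x : ρ x ≡ x) where

    even-period : ∀ h → iter σ (h + h) x ≡ x → iter σ h (ρ (iter σ h x)) ≡ iter σ h (iter σ h x)
    even-period h returns = begin
      iter σ h (ρ (iter σ h x)) ≡⟨ iter-reverses σ ρ ρ-reverses h x ⟩
      ρ x                       ≡⟨ ρx≡x ⟩
      x                         ≡⟨ returns ⟨
      iter σ (h + h) x          ≡⟨ iter-+ σ h h x ⟩
      iter σ h (iter σ h x)     ∎

    odd-period : ∀ j → iter σ (suc (j + j)) x ≡ x →
                 iter σ (suc j) (τ (iter σ j x)) ≡ iter σ (suc j) (iter σ j x)
    odd-period j returns = begin
      σ (iter σ j (τ (iter σ j x))) ≡⟨ cong σ (iter-reverses σ τ τ-reverses j x) ⟩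
      σ (τ x)                       ≡⟨ σ∘τ≗ρ x ⟩
      ρ x                           ≡⟨ ρx≡x ⟩
      x                             ≡⟨ returns ⟨
      σ (iter σ (j + j) x)          ≡⟨ cong σ (iter-+ σ j j x) ⟩
      σ (iter σ j (iter σ j x))     ∎

    -- Induction on the period: an
    -- odd period yields the fixed point, an even one halves the period.
    orbit-meets-τ-axis : (∀ z → ρ z ≡ z → z ≡ x) →
                         ∀ L → 0 < L → iter σ L x ≡ x → ∃[ k ] (τ (iter σ k x) ≡ iter σ k x)
    orbit-meets-τ-axis ρ-fixes-only-x = <-rec Goal descend
      where
      Goal : ℕ → Set
      Goal L = 0 < L → iter σ L x ≡ x → ∃[ k ] (τ (iter σ k x) ≡ iter σ k x)
      descend : ∀ L → (∀ {L′} → L′ < L → Goal L′) → Goal L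
      descend L shorter 0<L returns with parity L
      ... | j , inj₂ refl = j , iter-injective σ-injective (suc j) (odd-period j returns)
      ... | zero , inj₁ refl = ⊥-elim (<-irrefl refl 0<L)
      ... | suc h , inj₁ refl = shorter (s≤s (m≤n+m (suc h) h)) (s≤s z≤n)
            (ρ-fixes-only-x _ (iter-injective σ-injective (suc h) (even-period (suc h) returns)))

-- The cycles p and s.

negatives : ℕ → List ℤ
negatives n = map (λ k → - (+ suc k)) (upTo n)

pList-antisym : ∀ n → pList n ≡ antisym (negatives n)
pList-antisym n = cong (λ z → + 0 ∷ (negatives n ++ z)) (begin
  map (λ k → + suc k) (downFrom n)                      ≡⟨ map-∘ (downFrom n) ⟩
  map -_ (map (λ k → - (+ suc k)) (downFrom n))         ≡⟨ cong (λ z → map -_ (map (λ k → - (+ suc k)) z)) (reverse-upTo n) ⟨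
  map -_ (map (λ k → - (+ suc k)) (reverse (upTo n)))   ≡⟨ cong (map -_) (reverse-map (λ k → - (+ suc k)) (upTo n)) ⟩
  negrev (negatives n)                                  ∎)
  where open ≡-Reasoning

-- The last negative is -n; this places -n at the centre of p.
negatives-suc : ∀ m → negatives (suc m) ≡ negatives m ++ [ - (+ suc m) ]
negatives-suc m = trans (cong (map (λ k → - (+ suc k))) (sym (upTo-∷ʳ m)))
                        (map-++ (λ k → - (+ suc k)) (upTo m) [ m ])

pList-unique : ∀ n → Unique (pList n)
pList-unique n = All.tabulate 0∉ ∷ Unique.++⁺ (Unique.map⁺ neg-inj (Unique.upTo⁺ n))
                                             (Unique.map⁺ pos-inj (Unique.downFrom⁺ n)) disjoint
  where
  neg-inj : ∀ {a b} → - (+ suc a) ≡ - (+ suc b) → a ≡ b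
  neg-inj refl = refl
  pos-inj : ∀ {a b} → + suc a ≡ + suc b → a ≡ b
  pos-inj refl = refl
  0∉ : ∀ {v} → v ∈ negatives n ++ map (λ k → + suc k) (downFrom n) → + 0 ≢ v
  0∉ v∈ with ∈-++⁻ (negatives n) v∈
  ... | inj₁ v∈neg with ∈-map⁻ (λ k → - (+ suc k)) v∈neg
  ...   | _ , _ , refl = λ ()
  0∉ v∈ | inj₂ v∈pos with ∈-map⁻ (λ k → + suc k) v∈pos
  ...   | _ , _ , refl = λ ()
  disjoint : ∀ {v} → v ∈ negatives n × v ∈ map (λ k → + suc k) (downFrom n) → ⊥
  disjoint (v∈neg , v∈pos) with ∈-map⁻ (λ k → - (+ suc k)) v∈neg | ∈-map⁻ (λ k → + suc k) v∈pos
  ... | _ , _ , refl | _ , _ , ()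

tabulate-last : ∀ {A : Set} m (f : Fin (suc m) → A) →
                tabulate f ≡ tabulate (λ i → f (Fin.inject₁ i)) ++ [ f (fromℕ m) ]
tabulate-last zero f = refl
tabulate-last (suc m) f = cong (f Fin.zero ∷_) (tabulate-last m (λ i → f (Fin.suc i)))

module Theorem7 (m : ℕ) (sv : Fin (suc m) → ℤ) (s-unique : Unique (sList sv)) where
  open ≡-Reasoning

  n sₙ : ℤ
  n = + suc m
  sₙ = sv (fromℕ m)

  p s σ ρ τ : ℤ → ℤ
  p = cyclePerm (pList (suc m))
  s = cyclePerm (sList sv)
  σ = compose p s
  ρ x = p (- x)
  τ x = - s x

  p-antisym : pList (suc m) ≡ antisym (negatives m ++ [ - n ])
  p-antisym = trans (pList-antisym (suc m)) (cong antisym (negatives-suc m))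

  s-antisym : sList sv ≡ antisym (tabulate (λ i → sv (Fin.inject₁ i)) ++ [ sₙ ])
  s-antisym = cong antisym (tabulate-last m sv)

  module P = AntisymmetricEnd (negatives m) (- n) (subst Unique p-antisym (pList-unique (suc m)))
  module S = AntisymmetricEnd (tabulate (λ i → sv (Fin.inject₁ i))) sₙ (subst Unique s-antisym s-unique)

  p≡P : p ≡ P.c
  p≡P = cong cyclePerm p-antisym

  s≡S : s ≡ S.c
  s≡S = cong cyclePerm s-antisym

  ρ-involutive : ∀ x → ρ (ρ x) ≡ x
  ρ-involutive x = begin
    p (- p (- x))     ≡⟨ cong (λ c → c (- c (- x))) p≡P ⟩
    P.c (- P.c (- x)) ≡⟨ P.anti-involutive (- x) ⟩
    - - x             ≡⟨ neg-involutive x ⟩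
    x                 ∎

  τ-involutive : ∀ x → τ (τ x) ≡ x
  τ-involutive x = begin
    - s (- s x)       ≡⟨ cong (λ c → - c (- c x)) s≡S ⟩
    - S.c (- S.c x)   ≡⟨ cong -_ (S.anti-involutive x) ⟩
    - - x             ≡⟨ neg-involutive x ⟩
    x                 ∎

  σ≗ρ∘τ : ∀ x → σ x ≡ ρ (τ x)
  σ≗ρ∘τ x = cong p (sym (neg-involutive (s x)))

  -- n is the only fixed point of ρ, since -n is the last entry of negatives (suc m).
  ρ-fixes-n : ρ n ≡ n
  ρ-fixes-n = trans (cong (λ c → c (- n)) p≡P) P.maps-end

  ρ-fixes-only-n : ∀ z → ρ z ≡ z → z ≡ n
  ρ-fixes-only-n z ρz≡z = neg-injective (P.negates-only-end (- z) (begin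
    P.c (- z) ≡⟨ cong (λ c → c (- z)) p≡P ⟨
    p (- z)   ≡⟨ ρz≡z ⟩
    z         ≡⟨ neg-involutive z ⟨
    - - z     ∎))

  -- sₙ is the only fixed point of τ, since it is the last entry of s₁, …, sₙ.
  τ-fixes-only-sₙ : ∀ z → τ z ≡ z → z ≡ sₙ
  τ-fixes-only-sₙ z τz≡z = S.negates-only-end z (begin
    S.c z     ≡⟨ cong (λ c → c z) s≡S ⟨
    s z       ≡⟨ neg-involutive (s z) ⟨
    - - s z   ≡⟨ cong -_ τz≡z ⟩
    - z       ∎)

  open Reflections ρ τ σ ρ-involutive τ-involutive σ≗ρ∘τ public

  support : List ℤ
  support = sList sv ++ pList (suc m)

  σ-closed : ∀ {y} → y ∈ support → σ y ∈ support
  σ-closed y∈ = cyclePerm-closed (pList (suc m)) (∈-++⁺ʳ (sList sv))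
                  (cyclePerm-closed (sList sv) ∈-++⁺ˡ y∈)

  n∈support : n ∈ support
  n∈support = ∈-++⁺ʳ (sList sv) (there (∈-++⁺ʳ (negatives (suc m)) (here refl)))

  n-returns : ∃[ L ] (0 < L × iter σ L n ≡ n)
  n-returns = orbit-returns σ-injective support σ-closed n∈support

mainTheorem7 : (m : ℕ) (sv : Fin (suc m) → ℤ) →
    (∀ i → (- (+ suc m) ≤ sv i) × (sv i ≤ + suc m)) →
    Unique (sList sv) →
    ∃[ k ] (iter (compose (cyclePerm (pList (suc m))) (cyclePerm (sList sv))) k (+ suc m) ≡ sv (fromℕ m))
mainTheorem7 m sv _ s-unique =
  let open Theorem7 m sv s-unique
      (L , 0<L , σᴸn≡n) = n-returns
      (k , τ-fixes-σᵏn) = orbit-meets-τ-axis ρ-fixes-n ρ-fixes-only-n L 0<L σᴸn≡n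
  in k , τ-fixes-only-sₙ (iter σ k n) τ-fixes-σᵏn
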